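{- Let $\alpha=\alpha_1\alpha_2\cdots\alpha_n$ be a word of positive integers. The SR algorithm does not terminate on $\alpha$ if and only if $s_{\alpha_1}s_{\alpha_2}\cdots s_{\alpha_n}$ is a reduced expression for the permutation $s_{\alpha_1}s_{\alpha_2}\cdots s_{\alpha_n}$, i.e. this permutation has length exactly $n$ (it cannot be written as a product of fewer than $n$ adjacent transpositions).
   Context: $s_i$ denotes the adjacent transposition $(i,i+1)$ of the positive integers. A cell is a pair $(i,j)$ of integers with $i\ge 1$, $j\ge 0$. A tower diagram is a finite set $\mathcal T$ of cells such that $(i,j)\in\mathcal T$ and $0\le k\le j$ imply $(i,k)\in\mathcal T$. The cell $(i,j)$ lies on the diagonal $x+y=i+j$. Sliding: for a positive integer $\alpha$, $\alpha^{\searrow}\mathcal T$ is computed by the procedure $P(\gamma,m)$ started at $\gamma=\alpha$, $m=1$: (S1) if no cell $(i,j)\in\mathcal T$ with $i\ge m$ lies on $x+y=\gamma-1$: (a) if $(\gamma,0)\notin\mathcal T$ the result is $\mathcal T\cup\{(\gamma,0)\}$; (b) if $(\gamma,0)\in\mathcal T$, $(\gamma,1)\notin\mathcal T$ the slide terminates (without result); (c) if $(\gamma,0),(\gamma,1)\in\mathcal T$, continue with $P(\gamma+1,\gamma+1)$. (S2) Otherwise let $i\ge m$ be smallest with $(i,\gamma-1-i)\in\mathcal T$: (a) if $(i,\gamma-i)\notin\mathcal T$ the result is $\mathcal T\cup\{(i,\gamma-i)\}$; (b) if $(i,\gamma-i)\in\mathcal T$, $(i,\gamma-i+1)\notin\mathcal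 T$ the slide terminates; (c) if both are in $\mathcal T$, continue with $P(\gamma+1,i+1)$. SR algorithm on a word $\alpha_1\cdots\alpha_n$: set $\mathcal T^{(0)}=\varnothing$ and successively $\mathcal T^{(k)}=\alpha_k^{\searrow}\mathcal T^{(k-1)}$ for $k=1,\dots,n$; the algorithm terminates if one of these slides terminates. -}

module Defs where

open import Level using (0ℓ)
open import Data.Nat using (ℕ; zero; suc; _+_; _≤_; _<_)
open import Data.Nat.Properties using (_≟_)
open import Data.Product using (_×_; _,_)
open import Data.List using (List; []; _∷_; length; foldr)
open import Data.List.Relation.Unary.All using (All)
open import Data.Maybe using (Maybe; just; nothing)
open import Data.Empty using (⊥)
open import Function using (_∘_; id)
open import Relation.Nullary using (yes; no)
open import Relation.Unary using (Pred; _∈_; _∉_; _∪_; ∅; ｛_｝)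
open import Relation.Binary.PropositionalEquality using (_≡_)

s : ℕ → ℕ → ℕ
s i x with x ≟ i
... | yes _ = suc i
... | no _ with x ≟ suc i
...   | yes _ = i
...   | no _ = x

perm : List ℕ → ℕ → ℕ
perm = foldr (λ a f → s a ∘ f) id

PositiveWord : List ℕ → Set
PositiveWord = All (1 ≤_)

Reduced : List ℕ → Set
Reduced α = ∀ (β : List ℕ) → PositiveWord β →
            (∀ x → perm β x ≡ perm α x) → length α ≤ length β

Cell : Set
Cell = ℕ × ℕ

TowerDiagram : Set₁
TowerDiagram = Pred Cell 0ℓ

add : TowerDiagram → Cell → TowerDiagram
add T c = T ∪ ｛ c ｝

NoCellOn : TowerDiagram → ℕ → ℕ → Set
NoCellOn T m d = ∀ i j → m ≤ i → i + j ≡ d → (i , j) ∉ T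

FirstOn : TowerDiagram → ℕ → ℕ → ℕ → ℕ → Set
FirstOn T m d i j =
  m ≤ i × i + j ≡ d × (i , j) ∈ T ×
  (∀ k l → m ≤ k → k < i → k + l ≡ d → (k , l) ∉ T)

-- The procedure P(γ , m) with γ = suc d, as a relation.
-- P T d m (just T') : the slide yields the result T';
-- P T d m nothing   : the slide terminates (without result).
data P (T : TowerDiagram) : ℕ → ℕ → Maybe TowerDiagram → Set₁ where
  s1a : ∀ {d m} → NoCellOn T m d → (suc d , 0) ∉ T →
        P T d m (just (add T (suc d , 0)))
  s1b : ∀ {d m} → NoCellOn T m d → (suc d , 0) ∈ T → (suc d , 1) ∉ T →
        P T d m nothing
  s1c : ∀ {d m r} → NoCellOn T m d → (suc d , 0) ∈ T → (suc d , 1) ∈ T →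
        P T (suc d) (suc (suc d)) r → P T d m r
  s2a : ∀ {d m i j} → FirstOn T m d i j → (i , suc j) ∉ T →
        P T d m (just (add T (i , suc j)))
  s2b : ∀ {d m i j} → FirstOn T m d i j → (i , suc j) ∈ T →
        (i , suc (suc j)) ∉ T → P T d m nothing
  s2c : ∀ {d m i j r} → FirstOn T m d i j → (i , suc j) ∈ T →
        (i , suc (suc j)) ∈ T → P T (suc d) (suc i) r → P T d m r

data Slide : ℕ → TowerDiagram → Maybe TowerDiagram → Set₁ where
  slide : ∀ {d T r} → P T d 1 r → Slide (suc d) T r

-- A run of the SR algorithm from T through the word in which every
-- slide yields a result (i.e. the algorithm does not terminate)
data Run : TowerDiagram → List ℕ → Set₁ where
  done : ∀ {T} → Run T []
  step : ∀ {T T' a w} → Slide a T (just T') → Run T' w → Run T (a ∷ w)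

SRDoesNotTerminate : List ℕ → Set₁
SRDoesNotTerminate α = Run ∅ α

-- Let cᵢ(π) = #{b < π⁻¹(i) : π(b) > i}. The tower diagram with a column of height cᵢ(π)
-- over every i has one cell per inversion of π, so its size is the length of π. The SR
-- algorithm maintains exactly this diagram for π = s_{α₁}⋯s_{αₖ}: when a is slid in, the
-- diagonal being followed crosses column i just below row rᵢ = #{b < a : π(b) ≥ i}, and
-- the position of π⁻¹(i) relative to a and a + 1 (before, at, next, after) decides whether
-- the slide moves on, adds the cell (i, rᵢ), stops, or climbs to the next diagonal. So it
-- adds the one new inversion of π s_a when π(a) < π(a + 1) and terminates when
-- π(a) > π(a + 1).
-- Hence a complete run on α shows that s_{α₁}⋯s_{αₙ} has n inversions, so no expression of
-- it is shorter. Conversely, if the slide of a terminates after a reduced prefix γ, then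
-- π s_a has |γ| − 1 inversions, and bubble sort writes it with that many letters, which
-- gives an expression of γ a α two letters shorter.

module Submission where

open import Data.Empty using (⊥-elim)
open import Data.Maybe using (Maybe; just; nothing)
open import Data.List using (List; []; _∷_; _++_; length)
open import Data.List.Relation.Unary.All using (All; []; _∷_)
open import Data.List.Relation.Unary.All.Properties using (++⁺; ++⁻ˡ; ++⁻ʳ)
import Data.List.Relation.Unary.All as All
open import Function.Bundles using (_⇔_; mk⇔)
open import Data.List.Properties using (length-++; ++-assoc)
open import Data.Nat
open import Data.Nat.Properties
open import Data.Nat.Induction using (<-rec)
open import Data.List.Extrema ≤-totalOrder using (max; xs≤max)
open import Data.Product using (Σ; ∃; _×_; _,_; proj₁; proj₂)
open import Data.Sum using (inj₁; inj₂)
open import Relation.Binary.Definitions using (tri<; tri≈; tri>)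
open import Relation.Binary.PropositionalEquality
open import Relation.Nullary using (¬_; Dec; yes; no)
open import Relation.Unary using (∅; _∈_; _∉_; _⊆_; _≐_)
open import Algebra.Properties.CommutativeSemigroup +-commutativeSemigroup using (interchange)

open import Defs

s-self : ∀ a → s a a ≡ suc a
s-self a with a ≟ a
... | yes _ = refl
... | no a≢a = ⊥-elim (a≢a refl)

s-suc : ∀ a → s a (suc a) ≡ a
s-suc a with suc a ≟ a
... | yes 1+a≡a = ⊥-elim (1+n≢n 1+a≡a)
... | no _ with suc a ≟ suc a
...   | yes _ = refl
...   | no 1+a≢1+a = ⊥-elim (1+a≢1+a refl)

s-other : ∀ a {x} → x ≢ a → x ≢ suc a → s a x ≡ x
s-other a {x} x≢a x≢1+a with x ≟ a
... | yes x≡a = ⊥-elim (x≢a x≡a)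
... | no _ with x ≟ suc a
...   | yes x≡1+a = ⊥-elim (x≢1+a x≡1+a)
...   | no _ = refl

s-below : ∀ a {x} → x < a → s a x ≡ x
s-below a x<a = s-other a (<⇒≢ x<a) (<⇒≢ (m<n⇒m<1+n x<a))

s-above : ∀ a {x} → suc a < x → s a x ≡ x
s-above a 1+a<x = s-other a (>⇒≢ (<-trans (n<1+n a) 1+a<x)) (>⇒≢ 1+a<x)

data Position (x a : ℕ) : Set where
  before : x < a → Position x a
  at     : x ≡ a → Position x a
  next   : x ≡ suc a → Position x a
  after  : suc a < x → Position x a

position : ∀ x a → Position x a
position x a with <-cmp x a
... | tri< x<a _ _ = before x<a
... | tri≈ _ x≡a _ = at x≡a
... | tri> _ _ a<x with <-cmp x (suc a)
...   | tri< x<1+a _ _ = ⊥-elim (<⇒≱ a<x (m<1+n⇒m≤n x<1+a))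
...   | tri≈ _ x≡1+a _ = next x≡1+a
...   | tri> _ _ 1+a<x = after 1+a<x

s-involutive : ∀ a x → s a (s a x) ≡ x
s-involutive a x with position x a
... | before x<a = trans (cong (s a) (s-below a x<a)) (s-below a x<a)
... | at refl = trans (cong (s a) (s-self a)) (s-suc a)
... | next refl = trans (cong (s a) (s-suc a)) (s-self a)
... | after 1+a<x = trans (cong (s a) (s-above a 1+a<x)) (s-above a 1+a<x)

𝟙 : ∀ {A : Set} → Dec A → ℕ
𝟙 (yes _) = 1
𝟙 (no _)  = 0

𝟙-yes : ∀ {A : Set} → A → (d : Dec A) → 𝟙 d ≡ 1
𝟙-yes _ (yes _) = refl
𝟙-yes x (no ¬x) = ⊥-elim (¬x x)

𝟙-no : ∀ {A : Set} → ¬ A → (d : Dec A) → 𝟙 d ≡ 0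
𝟙-no ¬x (yes x) = ⊥-elim (¬x x)
𝟙-no _  (no _)  = refl

∑ : ℕ → (ℕ → ℕ) → ℕ
∑ zero    f = 0
∑ (suc n) f = ∑ n f + f n

syntax ∑ n (λ x → e) = ∑[ x < n ] e

∑-cong : ∀ n {f g : ℕ → ℕ} → (∀ x → x < n → f x ≡ g x) → ∑ n f ≡ ∑ n g
∑-cong zero    f≡g = refl
∑-cong (suc n) f≡g = cong₂ _+_ (∑-cong n (λ x x<n → f≡g x (m<n⇒m<1+n x<n))) (f≡g n (n<1+n n))

∑-distrib-+ : ∀ n (f g : ℕ → ℕ) → ∑[ x < n ] (f x + g x) ≡ ∑ n f + ∑ n g
∑-distrib-+ zero    f g = refl
∑-distrib-+ (suc n) f g =
  trans (cong (_+ (f n + g n)) (∑-distrib-+ n f g)) (interchange (∑ n f) (∑ n g) (f n) (g n))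

∑-indicator : ∀ n c → ∑[ x < n ] 𝟙 (x ≟ c) ≡ 𝟙 (c <? n)
∑-indicator zero    c = 𝟙-no n≮0 (c <? 0)
∑-indicator (suc n) c with n ≟ c
... | yes refl = begin
  ∑[ x < n ] 𝟙 (x ≟ n) + 1  ≡⟨ cong (_+ 1) (∑-indicator n n) ⟩
  𝟙 (n <? n) + 1            ≡⟨ cong (_+ 1) (𝟙-no (<-irrefl refl) (n <? n)) ⟩
  1                         ≡⟨ 𝟙-yes (n<1+n n) (n <? suc n) ⟨
  𝟙 (n <? suc n)            ∎
  where open ≡-Reasoning
... | no n≢c = begin
  ∑[ x < n ] 𝟙 (x ≟ c) + 0  ≡⟨ +-identityʳ _ ⟩
  ∑[ x < n ] 𝟙 (x ≟ c)      ≡⟨ ∑-indicator n c ⟩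
  𝟙 (c <? n)                ≡⟨ same-indicator ⟩
  𝟙 (c <? suc n)            ∎
  where
  open ≡-Reasoning
  same-indicator : 𝟙 (c <? n) ≡ 𝟙 (c <? suc n)
  same-indicator with c <? n | c <? suc n
  ... | yes _   | yes _     = refl
  ... | no _    | no _      = refl
  ... | yes c<n | no c≮1+n  = ⊥-elim (c≮1+n (m<n⇒m<1+n c<n))
  ... | no c≮n  | yes c<1+n = ⊥-elim (n≢c (≤-antisym (≮⇒≥ c≮n) (m<1+n⇒m≤n c<1+n)))

∑-pos : ∀ n (f : ℕ → ℕ) → 0 < ∑ n f → ∃ λ x → x < n × 0 < f x
∑-pos (suc n) f pos with f n in fn≡
... | suc _ = n , n<1+n n , subst (0 <_) (sym fn≡) z<s
... | zero with ∑-pos n f (subst (0 <_) (+-identityʳ (∑ n f)) pos)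
...   | x , x<n , fx>0 = x , m<n⇒m<1+n x<n , fx>0

term≤∑ : ∀ n (f : ℕ → ℕ) {x} → x < n → f x ≤ ∑ n f
term≤∑ (suc n) f x<1+n with m≤n⇒m<n∨m≡n (m<1+n⇒m≤n x<1+n)
... | inj₁ x<n  = ≤-trans (term≤∑ n f x<n) (m≤m+n _ _)
... | inj₂ refl = m≤n+m _ _

∑-mono-bound : ∀ (f : ℕ → ℕ) {m n} → m ≤ n → ∑ m f ≤ ∑ n f
∑-mono-bound f {n = zero}  z≤n = ≤-refl
∑-mono-bound f {n = suc n} m≤1+n with m≤n⇒m<n∨m≡n m≤1+n
... | inj₁ m<1+n = ≤-trans (∑-mono-bound f (m<1+n⇒m≤n m<1+n)) (m≤m+n _ _)
... | inj₂ refl  = ≤-refl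

∑-∘s : ∀ a n (f : ℕ → ℕ) → suc a < n → ∑[ x < n ] f (s a x) ≡ ∑ n f
∑-∘s a (suc n) f 1+a<1+n with suc a <? n
... | yes 1+a<n = cong₂ _+_ (∑-∘s a n f 1+a<n) (cong f (s-above a 1+a<n))
... | no 1+a≮n with ≤-antisym (m<1+n⇒m≤n 1+a<1+n) (≮⇒≥ 1+a≮n)
...   | refl = begin
  ∑[ x < a ] f (s a x) + f (s a a) + f (s a (suc a))
    ≡⟨ cong₂ (λ p q → p + f q + f (s a (suc a))) (∑-cong a (λ x x<a → cong f (s-below a x<a))) (s-self a) ⟩
  ∑ a f + f (suc a) + f (s a (suc a))
    ≡⟨ cong (λ q → ∑ a f + f (suc a) + f q) (s-suc a) ⟩
  ∑ a f + f (suc a) + f a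
    ≡⟨ +-assoc (∑ a f) _ _ ⟩
  ∑ a f + (f (suc a) + f a)
    ≡⟨ cong (∑ a f +_) (+-comm (f (suc a)) (f a)) ⟩
  ∑ a f + (f a + f (suc a))
    ≡⟨ +-assoc (∑ a f) _ _ ⟨
  ∑ a f + f a + f (suc a) ∎
  where open ≡-Reasoning

∑-bump : ∀ n (f g : ℕ → ℕ) {c} → c < n → (∀ x → g x ≡ f x + 𝟙 (x ≟ c)) → ∑ n g ≡ suc (∑ n f)
∑-bump n f g {c} c<n g≡f+δ = begin
  ∑ n g                             ≡⟨ ∑-cong n (λ x _ → g≡f+δ x) ⟩
  ∑[ x < n ] (f x + 𝟙 (x ≟ c))      ≡⟨ ∑-distrib-+ n f _ ⟩
  ∑ n f + ∑[ x < n ] 𝟙 (x ≟ c)      ≡⟨ cong (∑ n f +_) (trans (∑-indicator n c) (𝟙-yes c<n (c <? n))) ⟩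
  ∑ n f + 1                         ≡⟨ +-comm _ 1 ⟩
  suc (∑ n f)                       ∎
  where open ≡-Reasoning

record Perm : Set where
  field
    to      : ℕ → ℕ
    from    : ℕ → ℕ
    to-from : ∀ x → to (from x) ≡ x
    from-to : ∀ x → from (to x) ≡ x

open Perm

idPerm : Perm
idPerm = record { to = λ x → x ; from = λ x → x ; to-from = λ _ → refl ; from-to = λ _ → refl }

_·s_ : Perm → ℕ → Perm
π ·s a = record
  { to      = λ x → to π (s a x)
  ; from    = λ x → s a (from π x)
  ; to-from = λ x → trans (cong (to π) (s-involutive a (from π x))) (to-from π x)
  ; from-to = λ x → trans (cong (s a) (from-to π (s a x))) (s-involutive a x)
  }

_·w_ : Perm → List ℕ → Perm
π ·w []      = π
π ·w (a ∷ β) = (π ·s a) ·w β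

to-·w : ∀ π β x → to (π ·w β) x ≡ to π (perm β x)
to-·w π []      x = refl
to-·w π (a ∷ β) x = to-·w (π ·s a) β x

from≡⇒to≡ : ∀ π {i x} → from π i ≡ x → to π x ≡ i
from≡⇒to≡ π {i} refl = to-from π i

to≡⇒from≡ : ∀ π {x i} → to π x ≡ i → from π i ≡ x
to≡⇒from≡ π {x} refl = from-to π x

to-injective : ∀ π {x y} → to π x ≡ to π y → x ≡ y
to-injective π {x} eq = trans (sym (from-to π x)) (to≡⇒from≡ π (sym eq))

from-unique : ∀ π ρ → (∀ x → to π x ≡ to ρ x) → ∀ i → from π i ≡ from ρ i
from-unique π ρ π≗ρ i = sym (to≡⇒from≡ ρ (trans (sym (π≗ρ (from π i))) (to-from π i)))

to-suc≢0 : ∀ π {x} → to π 0 ≡ 0 → to π (suc x) ≢ 0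
to-suc≢0 π π0≡0 π[1+x]≡0 = 1+n≢0 (to-injective π (trans π[1+x]≡0 (sym π0≡0)))

descent-positive : ∀ π {x} → to π 0 ≡ 0 → to π (suc x) < to π x → 1 ≤ x
descent-positive π {zero}  π0≡0 descent = ⊥-elim (n≮0 (subst (to π 1 <_) π0≡0 descent))
descent-positive π {suc _} _    _       = s≤s z≤n

record SupportedBelow (N : ℕ) (π : Perm) : Set where
  field
    fixes-0 : to π 0 ≡ 0
    fixes-≥ : ∀ {x} → N ≤ x → to π x ≡ x

open SupportedBelow

module _ {N π} (supp : SupportedBelow N π) where

  to-< : ∀ {x} → x < N → to π x < N
  to-< {x} x<N with N ≤? to π x
  ... | no N≰πx = ≰⇒> N≰πx
  ... | yes N≤πx = ⊥-elim (<⇒≱ x<N (subst (N ≤_) (to-injective π (fixes-≥ supp N≤πx)) N≤πx))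

  from-< : ∀ {i} → i < N → from π i < N
  from-< {i} i<N with N ≤? from π i
  ... | no N≰π⁻¹i = ≰⇒> N≰π⁻¹i
  ... | yes N≤π⁻¹i = ⊥-elim (<⇒≱ i<N (subst (N ≤_) π⁻¹i≡i N≤π⁻¹i))
    where
    π⁻¹i≡i : from π i ≡ i
    π⁻¹i≡i = trans (sym (fixes-≥ supp N≤π⁻¹i)) (to-from π i)

WordBelow : ℕ → List ℕ → Set
WordBelow N = All (λ a → suc a < N)

supported-id : ∀ N → SupportedBelow N idPerm
supported-id N = record { fixes-0 = refl ; fixes-≥ = λ _ → refl }

supported-·s : ∀ {N π a} → 1 ≤ a → suc a < N → SupportedBelow N π → SupportedBelow N (π ·s a)
supported-·s {π = π} {a} 1≤a 1+a<N supp = record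
  { fixes-0 = trans (cong (to π) (s-below a 1≤a)) (fixes-0 supp)
  ; fixes-≥ = λ N≤x → trans (cong (to π) (s-above a (<-≤-trans 1+a<N N≤x))) (fixes-≥ supp N≤x)
  }

-- i ≤ π b rather than i < π b: the two agree for b < π⁻¹ i, and ≤ gives rank-suc-row.
rank : Perm → ℕ → ℕ → ℕ
rank π i x = ∑[ b < x ] 𝟙 (i ≤? to π b)

code : Perm → ℕ → ℕ
code π i = rank π i (from π i)

inversions : ℕ → Perm → ℕ
inversions N π = ∑ N (code π)

rank-mono : ∀ π i {x y} → x ≤ y → rank π i x ≤ rank π i y
rank-mono π i = ∑-mono-bound (λ b → 𝟙 (i ≤? to π b))

rank-suc : ∀ π i x → i ≤ to π x → rank π i (suc x) ≡ suc (rank π i x)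
rank-suc π i x i≤πx = trans (cong (rank π i x +_) (𝟙-yes i≤πx (i ≤? to π x))) (+-comm _ 1)

rank-< : ∀ π i {x y} → x < y → i ≤ to π x → suc (rank π i x) ≤ rank π i y
rank-< π i {x} {y} x<y i≤πx = subst (_≤ rank π i y) (rank-suc π i x i≤πx) (rank-mono π i x<y)

rank-1 : ∀ π → to π 0 ≡ 0 → ∀ x → rank π 1 (suc x) ≡ x
rank-1 π π0≡0 zero    = cong (λ y → 𝟙 (1 ≤? y)) π0≡0
rank-1 π π0≡0 (suc x) = trans (rank-suc π 1 (suc x) (n≢0⇒n>0 (to-suc≢0 π π0≡0))) (cong suc (rank-1 π π0≡0 x))

rank-suc-row : ∀ π i x → rank π i x ≡ rank π (suc i) x + 𝟙 (from π i <? x)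
rank-suc-row π i x = begin
  rank π i x
    ≡⟨ ∑-cong x (λ b _ → split b) ⟩
  ∑[ b < x ] (𝟙 (suc i ≤? to π b) + 𝟙 (b ≟ from π i))
    ≡⟨ ∑-distrib-+ x _ _ ⟩
  rank π (suc i) x + ∑[ b < x ] 𝟙 (b ≟ from π i)
    ≡⟨ cong (rank π (suc i) x +_) (∑-indicator x (from π i)) ⟩
  rank π (suc i) x + 𝟙 (from π i <? x) ∎
  where
  open ≡-Reasoning
  split : ∀ b → 𝟙 (i ≤? to π b) ≡ 𝟙 (suc i ≤? to π b) + 𝟙 (b ≟ from π i)
  split b with i ≤? to π b | suc i ≤? to π b | b ≟ from π i
  ... | yes _   | yes i<πb | yes refl = ⊥-elim (<-irrefl (sym (to-from π i)) i<πb)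
  ... | yes _   | yes _    | no _     = refl
  ... | yes _   | no _     | yes _    = refl
  ... | yes i≤πb | no i≮πb | no b≢π⁻¹i =
    ⊥-elim (b≢π⁻¹i (sym (to≡⇒from≡ π (≤-antisym (≮⇒≥ i≮πb) i≤πb))))
  ... | no i≰πb | yes i<πb | _        = ⊥-elim (i≰πb (<⇒≤ i<πb))
  ... | no i≰πb | no _     | yes refl = ⊥-elim (i≰πb (≤-reflexive (sym (to-from π i))))
  ... | no _    | no _     | no _     = refl

rank-suc-row-< : ∀ π i {x} → from π i < x → rank π i x ≡ suc (rank π (suc i) x)
rank-suc-row-< π i {x} π⁻¹i<x = trans (rank-suc-row π i x)
  (trans (cong (rank π (suc i) x +_) (𝟙-yes π⁻¹i<x (from π i <? x))) (+-comm _ 1))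

rank-suc-row-≥ : ∀ π i {x} → x ≤ from π i → rank π i x ≡ rank π (suc i) x
rank-suc-row-≥ π i {x} x≤π⁻¹i = trans (rank-suc-row π i x)
  (trans (cong (rank π (suc i) x +_) (𝟙-no (≤⇒≯ x≤π⁻¹i) (from π i <? x))) (+-identityʳ _))

code-before : ∀ π i {a} → from π i < a → suc (code π i) ≤ rank π i a
code-before π i π⁻¹i<a = rank-< π i π⁻¹i<a (≤-reflexive (sym (to-from π i)))

code-next : ∀ π i {a} → from π i ≡ suc a → i ≤ to π a → code π i ≡ suc (rank π i a)
code-next π i {a} π⁻¹i≡1+a i≤πa = trans (cong (rank π i) π⁻¹i≡1+a) (rank-suc π i a i≤πa)

code-after : ∀ π i {a} → suc a < from π i → i ≤ to π a → i ≤ to π (suc a) →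
             suc (suc (rank π i a)) ≤ code π i
code-after π i {a} 1+a<π⁻¹i i≤πa i≤π[1+a] =
  subst (_≤ code π i) (trans (rank-suc π i (suc a) i≤π[1+a]) (cong suc (rank-suc π i a i≤πa)))
        (rank-mono π i 1+a<π⁻¹i)

code-cong : ∀ π ρ → (∀ x → to π x ≡ to ρ x) → ∀ i → code π i ≡ code ρ i
code-cong π ρ π≗ρ i = trans (cong (rank π i) (from-unique π ρ π≗ρ i))
  (∑-cong (from ρ i) (λ b _ → cong (λ y → 𝟙 (i ≤? y)) (π≗ρ b)))

code-id : ∀ i → code idPerm i ≡ 0
code-id i = vanish i ≤-refl
  where
  vanish : ∀ n → n ≤ i → ∑[ b < n ] 𝟙 (i ≤? b) ≡ 0
  vanish zero    _     = refl
  vanish (suc n) 1+n≤i = cong₂ _+_ (vanish n (<⇒≤ 1+n≤i)) (𝟙-no (<⇒≱ 1+n≤i) (i ≤? n))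

module _ (π : Perm) (a : ℕ) (ascent : to π a < to π (suc a)) (i : ℕ) where

  private
    f : ℕ → ℕ
    f b = 𝟙 (i ≤? to π b)

    sum-below : ∑[ b < a ] f (s a b) ≡ ∑ a f
    sum-below = ∑-cong a (λ b b<a → cong f (s-below a b<a))

    not-at : from π i ≢ a → 𝟙 (i ≟ to π a) ≡ 0
    not-at π⁻¹i≢a = 𝟙-no (λ i≡πa → π⁻¹i≢a (to≡⇒from≡ π (sym i≡πa))) (i ≟ to π a)

  code-·s-ascent : code (π ·s a) i ≡ code π i + 𝟙 (i ≟ to π a)
  code-·s-ascent with position (from π i) a
  ... | before π⁻¹i<a = begin
    ∑[ b < s a (from π i) ] f (s a b)
      ≡⟨ cong (λ n → ∑[ b < n ] f (s a b)) (s-below a π⁻¹i<a) ⟩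
    ∑[ b < from π i ] f (s a b)
      ≡⟨ ∑-cong (from π i) (λ b b<π⁻¹i → cong f (s-below a (<-trans b<π⁻¹i π⁻¹i<a))) ⟩
    code π i
      ≡⟨ +-identityʳ _ ⟨
    code π i + 0
      ≡⟨ cong (code π i +_) (not-at (<⇒≢ π⁻¹i<a)) ⟨
    code π i + 𝟙 (i ≟ to π a) ∎
    where open ≡-Reasoning
  ... | after 1+a<π⁻¹i = begin
    ∑[ b < s a (from π i) ] f (s a b)
      ≡⟨ cong (λ n → ∑[ b < n ] f (s a b)) (s-above a 1+a<π⁻¹i) ⟩
    ∑[ b < from π i ] f (s a b)
      ≡⟨ ∑-∘s a (from π i) f 1+a<π⁻¹i ⟩
    code π i
      ≡⟨ +-identityʳ _ ⟨
    code π i + 0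
      ≡⟨ cong (code π i +_) (not-at (>⇒≢ (<-trans (n<1+n a) 1+a<π⁻¹i))) ⟨
    code π i + 𝟙 (i ≟ to π a) ∎
    where open ≡-Reasoning
  ... | at refl = begin
    ∑[ b < s a a ] f (s a b)
      ≡⟨ cong (λ n → ∑[ b < n ] f (s a b)) (s-self a) ⟩
    ∑[ b < a ] f (s a b) + f (s a a)
      ≡⟨ cong₂ _+_ sum-below (cong f (s-self a)) ⟩
    ∑ a f + f (suc a)
      ≡⟨ cong (∑ a f +_) (𝟙-yes (<⇒≤ i<π[1+a]) (i ≤? to π (suc a))) ⟩
    ∑ a f + 1
      ≡⟨ cong (∑ a f +_) (𝟙-yes i≡πa (i ≟ to π a)) ⟨
    ∑ a f + 𝟙 (i ≟ to π a) ∎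
    where
    open ≡-Reasoning
    i≡πa : i ≡ to π a
    i≡πa = sym (to-from π i)
    i<π[1+a] : i < to π (suc a)
    i<π[1+a] = subst (_< to π (suc a)) (sym i≡πa) ascent
  ... | next π⁻¹i≡1+a = begin
    ∑[ b < s a (from π i) ] f (s a b)
      ≡⟨ cong (λ n → ∑[ b < n ] f (s a b)) (trans (cong (s a) π⁻¹i≡1+a) (s-suc a)) ⟩
    ∑[ b < a ] f (s a b)
      ≡⟨ sum-below ⟩
    ∑ a f
      ≡⟨ trans (cong (∑ a f +_) (𝟙-no i≰πa (i ≤? to π a))) (+-identityʳ _) ⟨
    ∑ (suc a) f
      ≡⟨ cong (λ n → ∑ n f) π⁻¹i≡1+a ⟨
    code π i
      ≡⟨ +-identityʳ _ ⟨
    code π i + 0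
      ≡⟨ cong (code π i +_) (not-at (λ π⁻¹i≡a → 1+n≢n (trans (sym π⁻¹i≡1+a) π⁻¹i≡a))) ⟨
    code π i + 𝟙 (i ≟ to π a) ∎
    where
    open ≡-Reasoning
    i≰πa : ¬ i ≤ to π a
    i≰πa = <⇒≱ (subst (to π a <_) (from≡⇒to≡ π π⁻¹i≡1+a) ascent)

code-·s-descent : ∀ π a → to π (suc a) < to π a →
                  ∀ i → code π i ≡ code (π ·s a) i + 𝟙 (i ≟ to π (suc a))
code-·s-descent π a descent i = begin
  code π i
    ≡⟨ code-cong ((π ·s a) ·s a) π (λ x → cong (to π) (s-involutive a x)) i ⟨
  code ((π ·s a) ·s a) i
    ≡⟨ code-·s-ascent (π ·s a) a ascent i ⟩
  code (π ·s a) i + 𝟙 (i ≟ to π (s a a))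
    ≡⟨ cong (λ y → code (π ·s a) i + 𝟙 (i ≟ to π y)) (s-self a) ⟩
  code (π ·s a) i + 𝟙 (i ≟ to π (suc a)) ∎
  where
  open ≡-Reasoning
  ascent : to π (s a a) < to π (s a (suc a))
  ascent = subst₂ (λ x y → to π x < to π y) (sym (s-self a)) (sym (s-suc a)) descent

inversions-cong : ∀ N π ρ → (∀ x → to π x ≡ to ρ x) → inversions N π ≡ inversions N ρ
inversions-cong N π ρ π≗ρ = ∑-cong N (λ i _ → code-cong π ρ π≗ρ i)

inversions-id : ∀ N → inversions N idPerm ≡ 0
inversions-id zero    = refl
inversions-id (suc N) = cong₂ _+_ (inversions-id N) (code-id N)

inversions-·s-ascent : ∀ {N} π a → to π a < N → to π a < to π (suc a) →
                       inversions N (π ·s a) ≡ suc (inversions N π)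
inversions-·s-ascent {N} π a πa<N ascent = ∑-bump N (code π) (code (π ·s a)) πa<N (code-·s-ascent π a ascent)

inversions-·s-descent : ∀ {N} π a → to π (suc a) < N → to π (suc a) < to π a →
                        inversions N π ≡ suc (inversions N (π ·s a))
inversions-·s-descent {N} π a π[1+a]<N descent =
  ∑-bump N (code (π ·s a)) (code π) π[1+a]<N (code-·s-descent π a descent)

inversions-·s-≤ : ∀ {N π} a → SupportedBelow N π → suc a < N → inversions N (π ·s a) ≤ suc (inversions N π)
inversions-·s-≤ {N} {π} a supp 1+a<N with <-cmp (to π a) (to π (suc a))
... | tri< ascent _ _ = ≤-reflexive (inversions-·s-ascent π a (to-< supp (<-trans (n<1+n a) 1+a<N)) ascent)
... | tri≈ _ πa≡π[1+a] _ = ⊥-elim (1+n≢n (sym (to-injective π πa≡π[1+a])))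
... | tri> _ _ descent = begin
  inversions N (π ·s a)        ≤⟨ n≤1+n _ ⟩
  suc (inversions N (π ·s a))  ≡⟨ inversions-·s-descent π a (to-< supp 1+a<N) descent ⟨
  inversions N π               ≤⟨ n≤1+n _ ⟩
  suc (inversions N π)         ∎
  where open ≤-Reasoning

inversions-·w-≤ : ∀ {N} π β → WordBelow N β → PositiveWord β → SupportedBelow N π →
                  inversions N (π ·w β) ≤ inversions N π + length β
inversions-·w-≤ {N} π []      []             []           supp = ≤-reflexive (sym (+-identityʳ _))
inversions-·w-≤ {N} π (a ∷ β) (1+a<N ∷ β<N) (1≤a ∷ β>0) supp = begin
  inversions N ((π ·s a) ·w β)
    ≤⟨ inversions-·w-≤ (π ·s a) β β<N β>0 (supported-·s 1≤a 1+a<N supp) ⟩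
  inversions N (π ·s a) + length β
    ≤⟨ +-monoˡ-≤ (length β) (inversions-·s-≤ a supp 1+a<N) ⟩
  suc (inversions N π) + length β
    ≡⟨ +-suc _ _ ⟨
  inversions N π + suc (length β) ∎
  where open ≤-Reasoning

perm-++ : ∀ xs ys x → perm (xs ++ ys) x ≡ perm xs (perm ys x)
perm-++ []       ys x = refl
perm-++ (a ∷ xs) ys x = cong (s a) (perm-++ xs ys x)

descent-between : ∀ (f : ℕ → ℕ) {b c} → b < c → f c < f b → ∃ λ a → b ≤ a × suc a ≤ c × f (suc a) < f a
descent-between f {b} {suc c} b<1+c fc<fb with m≤n⇒m<n∨m≡n (m<1+n⇒m≤n b<1+c) | f (suc c) <? f c
... | inj₂ refl | _            = b , ≤-refl , ≤-refl , fc<fb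
... | inj₁ b<c  | yes descent  = c , <⇒≤ b<c , ≤-refl , descent
... | inj₁ b<c  | no f[1+c]≮fc with descent-between f b<c (≤-<-trans (≮⇒≥ f[1+c]≮fc) fc<fb)
...   | a , b≤a , 1+a≤c , descent = a , b≤a , m≤n⇒m≤1+n 1+a≤c , descent

module _ {N π} (supp : SupportedBelow N π) where

  from-identity : (∀ i → i < N → code π i ≡ 0) → ∀ i → i < N → from π i ≡ i
  from-identity code≡0 = <-rec (λ i → i < N → from π i ≡ i) fixed-if-below-fixed
    where
    fixed-if-below-fixed : ∀ i → (∀ {j} → j < i → j < N → from π j ≡ j) → i < N → from π i ≡ i
    fixed-if-below-fixed i ih i<N with <-cmp (from π i) i
    ... | tri≈ _ π⁻¹i≡i _ = π⁻¹i≡i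
    ... | tri< π⁻¹i<i _ _ = ⊥-elim (<-irrefl (sym i≡π⁻¹i) π⁻¹i<i)
      where
      i≡π⁻¹i : i ≡ from π i
      i≡π⁻¹i = trans (sym (to-from π i))
                     (trans (cong (to π) (sym (ih π⁻¹i<i (<-trans π⁻¹i<i i<N)))) (to-from π (from π i)))
    ... | tri> _ _ i<π⁻¹i =
      ⊥-elim (<-irrefl (sym (code≡0 i i<N)) (<-≤-trans 0<1 (term≤∑ (from π i) _ i<π⁻¹i)))
      where
      i≤πi : i ≤ to π i
      i≤πi with to π i <? i
      ... | no πi≮i = ≮⇒≥ πi≮i
      ... | yes πi<i = ⊥-elim (<-irrefl (trans (sym (ih πi<i (<-trans πi<i i<N))) (from-to π i)) πi<i)
      0<1 : 0 < 𝟙 (i ≤? to π i)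
      0<1 = subst (0 <_) (sym (𝟙-yes i≤πi (i ≤? to π i))) z<s

  no-inversions⇒identity : inversions N π ≡ 0 → ∀ x → to π x ≡ x
  no-inversions⇒identity inv≡0 x with x <? N
  ... | yes x<N = trans (cong (to π) (sym (from-identity code≡0 x x<N))) (to-from π x)
    where
    code≡0 : ∀ i → i < N → code π i ≡ 0
    code≡0 i i<N = n≤0⇒n≡0 (subst (code π i ≤_) inv≡0 (term≤∑ N (code π) i<N))
  ... | no x≮N = fixes-≥ supp (≮⇒≥ x≮N)

  descent-exists : 0 < inversions N π → ∃ λ a → 1 ≤ a × suc a < N × to π (suc a) < to π a
  descent-exists inv>0 with ∑-pos N (code π) inv>0
  ... | i , i<N , code>0 with ∑-pos (from π i) (λ b → 𝟙 (i ≤? to π b)) code>0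
  ... | b , b<π⁻¹i , counted with descent-between (to π) b<π⁻¹i inversion
    where
    inversion : to π (from π i) < to π b
    inversion with i ≤? to π b
    ... | no _ = ⊥-elim (<-irrefl refl counted)
    ... | yes i≤πb = subst (_< to π b) (sym (to-from π i)) (≤∧≢⇒< i≤πb i≢πb)
      where
      i≢πb : i ≢ to π b
      i≢πb i≡πb = <-irrefl (sym (to≡⇒from≡ π (sym i≡πb))) b<π⁻¹i
  ... | a , _ , 1+a≤π⁻¹i , descent =
    a , descent-positive π (fixes-0 supp) descent , ≤-<-trans 1+a≤π⁻¹i (from-< supp i<N) , descent

record Expression (N : ℕ) (π : Perm) (k : ℕ) : Set where
  field
    word       : List ℕ
    positive   : PositiveWord word
    below      : WordBelow N word
    represents : ∀ x → perm word x ≡ to π x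
    length≡    : length word ≡ k

open Expression

expression : ∀ {N} k {π} → SupportedBelow N π → inversions N π ≡ k → Expression N π k
expression zero    supp inv≡0 = record
  { word = [] ; positive = [] ; below = [] ; length≡ = refl
  ; represents = λ x → sym (no-inversions⇒identity supp inv≡0 x)
  }
expression (suc k) {π} supp inv≡1+k with descent-exists supp (subst (0 <_) (sym inv≡1+k) z<s)
... | a , 1≤a , 1+a<N , descent = record
  { word       = word δ ++ a ∷ []
  ; positive   = ++⁺ (positive δ) (1≤a ∷ [])
  ; below      = ++⁺ (below δ) (1+a<N ∷ [])
  ; represents = λ x → trans (perm-++ (word δ) (a ∷ []) x)
                             (trans (represents δ (s a x)) (cong (to π) (s-involutive a x)))
  ; length≡    = trans (length-++ (word δ)) (trans (+-comm _ 1) (cong suc (length≡ δ)))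
  }
  where
  δ : Expression _ (π ·s a) k
  δ = expression k (supported-·s 1≤a 1+a<N supp)
        (suc-injective (trans (sym (inversions-·s-descent π a (to-< supp 1+a<N) descent)) inv≡1+k))

diagram : Perm → TowerDiagram
diagram π (i , j) = j < code π i

diagram-id : ∅ ≐ diagram idPerm
diagram-id = (λ ()) , λ {(i , j)} j<code → ⊥-elim (n≮0 (subst (j <_) (code-id i) j<code))

diagram-·s-ascent : ∀ {T} π a → T ≐ diagram π → to π a < to π (suc a) →
                    add T (to π a , code π (to π a)) ≐ diagram (π ·s a)
diagram-·s-ascent {T} π a (T⊆ , ⊆T) ascent = grow , shrink
  where
  code′ : ∀ i → code (π ·s a) i ≡ code π i + 𝟙 (i ≟ to π a)
  code′ = code-·s-ascent π a ascent
  grow : add T (to π a , code π (to π a)) ⊆ diagram (π ·s a)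
  grow {i , j} (inj₁ ij∈T) = subst (j <_) (sym (code′ i)) (≤-trans (T⊆ ij∈T) (m≤m+n _ _))
  grow {i , j} (inj₂ refl) =
    subst (j <_) (sym (code′ i)) (subst (λ k → code π i < code π i + k) (sym (𝟙-yes refl (i ≟ i))) (m<m+n _ z<s))
  shrink : diagram (π ·s a) ⊆ add T (to π a , code π (to π a))
  shrink {i , j} j<code′ with i ≟ to π a | subst (j <_) (code′ i) j<code′
  ... | no _    | j<code+0 = inj₁ (⊆T (subst (j <_) (+-identityʳ _) j<code+0))
  ... | yes refl | j<code+1 with m≤n⇒m<n∨m≡n (m<1+n⇒m≤n (subst (j <_) (+-comm _ 1) j<code+1))
  ...   | inj₁ j<code = inj₁ (⊆T j<code)
  ...   | inj₂ refl   = inj₂ refl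

no-first : ∀ {T m d i j} → NoCellOn T m d → ¬ FirstOn T m d i j
no-first none (m≤i , on-d , ∈T , _) = none _ _ m≤i on-d ∈T

first-unique : ∀ {T m d i j i' j'} → FirstOn T m d i j → FirstOn T m d i' j' → i ≡ i' × j ≡ j'
first-unique {i = i} {j} {i'} {j'} (m≤i , on-d , ∈T , first) (m≤i' , on-d' , ∈T' , first') with <-cmp i i'
... | tri< i<i' _ _ = ⊥-elim (first' i j m≤i i<i' on-d ∈T)
... | tri> _ _ i'<i = ⊥-elim (first i' j' m≤i' i'<i on-d' ∈T')
... | tri≈ _ refl _ = refl , +-cancelˡ-≡ i j j' (trans on-d (sym on-d'))

P-deterministic : ∀ {T d m r₁ r₂} → P T d m r₁ → P T d m r₂ → r₁ ≡ r₂
P-deterministic (s1a _ _) (s1a _ _) = refl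
P-deterministic (s1a _ ∉T) (s1b _ ∈T _) = ⊥-elim (∉T ∈T)
P-deterministic (s1a _ ∉T) (s1c _ ∈T _ _) = ⊥-elim (∉T ∈T)
P-deterministic (s1a none _) (s2a f _) = ⊥-elim (no-first none f)
P-deterministic (s1a none _) (s2b f _ _) = ⊥-elim (no-first none f)
P-deterministic (s1a none _) (s2c f _ _ _) = ⊥-elim (no-first none f)
P-deterministic (s1b _ ∈T _) (s1a _ ∉T) = ⊥-elim (∉T ∈T)
P-deterministic (s1b _ _ _) (s1b _ _ _) = refl
P-deterministic (s1b _ _ ∉T) (s1c _ _ ∈T _) = ⊥-elim (∉T ∈T)
P-deterministic (s1b none _ _) (s2a f _) = ⊥-elim (no-first none f)
P-deterministic (s1b none _ _) (s2b f _ _) = ⊥-elim (no-first none f)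
P-deterministic (s1b none _ _) (s2c f _ _ _) = ⊥-elim (no-first none f)
P-deterministic (s1c _ ∈T _ _) (s1a _ ∉T) = ⊥-elim (∉T ∈T)
P-deterministic (s1c _ _ ∈T _) (s1b _ _ ∉T) = ⊥-elim (∉T ∈T)
P-deterministic (s1c _ _ _ p) (s1c _ _ _ q) = P-deterministic p q
P-deterministic (s1c none _ _ _) (s2a f _) = ⊥-elim (no-first none f)
P-deterministic (s1c none _ _ _) (s2b f _ _) = ⊥-elim (no-first none f)
P-deterministic (s1c none _ _ _) (s2c f _ _ _) = ⊥-elim (no-first none f)
P-deterministic (s2a f _) (s1a none _) = ⊥-elim (no-first none f)
P-deterministic (s2a f _) (s1b none _ _) = ⊥-elim (no-first none f)
P-deterministic (s2a f _) (s1c none _ _ _) = ⊥-elim (no-first none f)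
P-deterministic (s2b f _ _) (s1a none _) = ⊥-elim (no-first none f)
P-deterministic (s2b f _ _) (s1b none _ _) = ⊥-elim (no-first none f)
P-deterministic (s2b f _ _) (s1c none _ _ _) = ⊥-elim (no-first none f)
P-deterministic (s2c f _ _ _) (s1a none _) = ⊥-elim (no-first none f)
P-deterministic (s2c f _ _ _) (s1b none _ _) = ⊥-elim (no-first none f)
P-deterministic (s2c f _ _ _) (s1c none _ _ _) = ⊥-elim (no-first none f)
P-deterministic (s2a f ∉T) (s2a f′ _) with first-unique f f′
... | refl , refl = refl
P-deterministic (s2a f ∉T) (s2b f′ ∈T _) with first-unique f f′
... | refl , refl = ⊥-elim (∉T ∈T)
P-deterministic (s2a f ∉T) (s2c f′ ∈T _ _) with first-unique f f′
... | refl , refl = ⊥-elim (∉T ∈T)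
P-deterministic (s2b f ∈T _) (s2a f′ ∉T) with first-unique f f′
... | refl , refl = ⊥-elim (∉T ∈T)
P-deterministic (s2b f _ _) (s2b f′ _ _) with first-unique f f′
... | refl , refl = refl
P-deterministic (s2b f _ ∉T) (s2c f′ _ ∈T _) with first-unique f f′
... | refl , refl = ⊥-elim (∉T ∈T)
P-deterministic (s2c f ∈T _ _) (s2a f′ ∉T) with first-unique f f′
... | refl , refl = ⊥-elim (∉T ∈T)
P-deterministic (s2c f _ ∈T _) (s2b f′ _ ∉T) with first-unique f f′
... | refl , refl = ⊥-elim (∉T ∈T)
P-deterministic (s2c f _ _ p) (s2c f′ _ _ q) with first-unique f f′
... | refl , refl = P-deterministic p q

NoCellIn : TowerDiagram → ℕ → ℕ → ℕ → Set
NoCellIn T m i d = ∀ k l → m ≤ k → k < i → k + l ≡ d → (k , l) ∉ T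

no-cell-in-empty : ∀ {T m i d} → i ≤ m → NoCellIn T m i d
no-cell-in-empty i≤m k l m≤k k<i _ _ = <⇒≱ k<i (≤-trans i≤m m≤k)

no-cell-in-extend : ∀ {T m i d l} → NoCellIn T m i d → i + l ≡ d → (i , l) ∉ T → NoCellIn T m (suc i) d
no-cell-in-extend none i+l≡d il∉T k l′ m≤k k<1+i k+l′≡d with m≤n⇒m<n∨m≡n (m<1+n⇒m≤n k<1+i)
... | inj₁ k<i  = none k l′ m≤k k<i k+l′≡d
... | inj₂ refl with +-cancelˡ-≡ k l′ _ (trans k+l′≡d (sym i+l≡d))
...   | refl = il∉T

no-cell-in⇒on : ∀ {T m d} → NoCellIn T m (suc d) d → NoCellOn T m d
no-cell-in⇒on none k l m≤k k+l≡d = none k l m≤k (s≤s (subst (k ≤_) k+l≡d (m≤m+n k l))) k+l≡d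

module Sliding {T : TowerDiagram} (π : Perm) (T≐π : T ≐ diagram π) (a : ℕ) where

  data Outcome : Maybe TowerDiagram → Set₁ where
    grows : to π a < to π (suc a) → Outcome (just (add T (to π a , code π (to π a))))
    stops : to π (suc a) < to π a → Outcome nothing

  SlideFrom : ℕ → ℕ → Set₁
  SlideFrom d m = Σ (Maybe TowerDiagram) λ r → P T d m r × Outcome r

  private
    in-T : ∀ {i j} → j < code π i → (i , j) ∈ T
    in-T = proj₂ T≐π

    out-T : ∀ {i j} → code π i ≤ j → (i , j) ∉ T
    out-T code≤j ij∈T = <⇒≱ (proj₁ T≐π ij∈T) code≤j

    πa≢π[1+a] : to π a ≢ to π (suc a)
    πa≢π[1+a] πa≡π[1+a] = 1+n≢n (sym (to-injective π πa≡π[1+a]))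

    grows-at : ∀ {d m i j} → from π i ≡ a → i ≤ to π (suc a) → j ≡ code π i →
               P T d m (just (add T (i , j))) → SlideFrom d m
    grows-at {d} {m} π⁻¹i≡a i≤π[1+a] refl p =
      _ , subst (λ c → P T d m (just (add T c))) (cong (λ x → x , code π x) (sym (from≡⇒to≡ π π⁻¹i≡a))) p ,
      grows (≤∧≢⇒< (subst (_≤ to π (suc a)) (sym (from≡⇒to≡ π π⁻¹i≡a)) i≤π[1+a]) πa≢π[1+a])

    stops-at : ∀ {d m i} → from π i ≡ suc a → i ≤ to π a → P T d m nothing → SlideFrom d m
    stops-at π⁻¹i≡1+a i≤πa p =
      nothing , p ,
      stops (≤∧≢⇒< (subst (_≤ to π a) (sym (from≡⇒to≡ π π⁻¹i≡1+a)) i≤πa) (≢-sym πa≢π[1+a]))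

    end-of-gap : ∀ {i} → i + 0 ≡ to π a → from π i ≡ a
    end-of-gap {i} i+0≡πa = to≡⇒from≡ π (sym (trans (sym (+-identityʳ i)) i+0≡πa))

    step-right : ∀ {i} → i ≤ to π (suc a) → from π i ≢ suc a → suc i ≤ to π (suc a)
    step-right {i} i≤π[1+a] π⁻¹i≢1+a =
      ≤∧≢⇒< i≤π[1+a] (λ i≡π[1+a] → π⁻¹i≢1+a (to≡⇒from≡ π (sym i≡π[1+a])))

    gap-bound : ∀ {i gap} → i + gap ≡ to π a → i ≤ to π a
    gap-bound {i} {gap} i+gap≡πa = subst (i ≤_) i+gap≡πa (m≤m+n i gap)

    after-not-end : ∀ {i} → suc a < from π i → i + 0 ≢ to π a
    after-not-end 1+a<π⁻¹i i+0≡πa = <⇒≱ 1+a<π⁻¹i (≤-trans (≤-reflexive (end-of-gap i+0≡πa)) (n≤1+n a))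

  -- Row 0: the diagonal passes below column i = d + 1, so rule S1 applies.
  scan-off : ∀ gap d m → suc d + gap ≡ to π a → suc d ≤ to π (suc a) → rank π (suc d) a ≡ 0 →
             NoCellOn T m d → SlideFrom d m
  scan-off gap d m i+gap≡πa i≤π[1+a] rank≡0 none with position (from π (suc d)) a | gap
  ... | before π⁻¹i<a | _ = ⊥-elim (n≮0 (subst (code π (suc d) <_) rank≡0 (code-before π (suc d) π⁻¹i<a)))
  ... | at π⁻¹i≡a | _ = grows-at π⁻¹i≡a i≤π[1+a] (sym code≡0) (s1a none (out-T (≤-reflexive code≡0)))
    where
    code≡0 : code π (suc d) ≡ 0
    code≡0 = trans (cong (rank π (suc d)) π⁻¹i≡a) rank≡0
  ... | next π⁻¹i≡1+a | _ = stops-at π⁻¹i≡1+a (gap-bound i+gap≡πa)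
                          (s1b none (in-T (subst (0 <_) (sym code≡1) z<s)) (out-T (≤-reflexive code≡1)))
    where
    code≡1 : code π (suc d) ≡ 1
    code≡1 = trans (code-next π (suc d) π⁻¹i≡1+a (gap-bound i+gap≡πa)) (cong suc rank≡0)
  ... | after 1+a<π⁻¹i | zero     = ⊥-elim (after-not-end 1+a<π⁻¹i i+gap≡πa)
  ... | after 1+a<π⁻¹i | suc gap′
    with scan-off gap′ (suc d) (suc (suc d)) (trans (sym (+-suc (suc d) gap′)) i+gap≡πa)
                          (step-right i≤π[1+a] (>⇒≢ 1+a<π⁻¹i))
                          (trans (sym (rank-suc-row-≥ π (suc d) (<⇒≤ (<-trans (n<1+n a) 1+a<π⁻¹i)))) rank≡0)
                          (no-cell-in⇒on (no-cell-in-empty ≤-refl))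
  ...   | r , p , outcome = r , s1c none (in-T (<-≤-trans z<s 2≤code)) (in-T 2≤code) p , outcome
    where
    2≤code : 2 ≤ code π (suc d)
    2≤code = subst (λ k → suc (suc k) ≤ code π (suc d)) rank≡0
               (code-after π (suc d) 1+a<π⁻¹i (gap-bound i+gap≡πa) i≤π[1+a])

  mutual
    scan : ∀ gap d m i k → i + gap ≡ to π a → m ≤ i → i ≤ to π (suc a) →
           rank π i a ≡ k → k + i ≡ suc d → NoCellIn T m i d → SlideFrom d m
    scan gap d m .(suc d) zero    i+gap≡πa _   i≤π[1+a] rank≡0 refl none =
      scan-off gap d m i+gap≡πa i≤π[1+a] rank≡0 (no-cell-in⇒on none)
    scan gap d m i        (suc l) i+gap≡πa m≤i i≤π[1+a] rank≡  diag none =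
      scan-on gap d m i l i+gap≡πa m≤i i≤π[1+a] rank≡ (trans (+-comm i l) (suc-injective diag)) none

    scan-on : ∀ gap d m i l → i + gap ≡ to π a → m ≤ i → i ≤ to π (suc a) →
              rank π i a ≡ suc l → i + l ≡ d → NoCellIn T m i d → SlideFrom d m
    scan-on gap d m i l i+gap≡πa m≤i i≤π[1+a] rank≡ i+l≡d none with position (from π i) a | gap
    ... | before π⁻¹i<a | zero     = ⊥-elim (<-irrefl (end-of-gap i+gap≡πa) π⁻¹i<a)
    ... | before π⁻¹i<a | suc gap′ =
      scan gap′ d m (suc i) l (trans (sym (+-suc i gap′)) i+gap≡πa) (m≤n⇒m≤1+n m≤i)
           (step-right i≤π[1+a] (<⇒≢ (<-trans π⁻¹i<a (n<1+n a))))
           (suc-injective (trans (sym (rank-suc-row-< π i π⁻¹i<a)) rank≡))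
           (trans (+-suc l i) (cong suc (trans (+-comm l i) i+l≡d)))
           (no-cell-in-extend none i+l≡d (out-T (m<1+n⇒m≤n (subst (code π i <_) rank≡ (code-before π i π⁻¹i<a)))))
    ... | at π⁻¹i≡a | _ =
      grows-at π⁻¹i≡a i≤π[1+a] (sym code≡)
        (s2a (m≤i , i+l≡d , in-T (subst (l <_) (sym code≡) (n<1+n l)) , none) (out-T (≤-reflexive code≡)))
      where
      code≡ : code π i ≡ suc l
      code≡ = trans (cong (rank π i) π⁻¹i≡a) rank≡
    ... | next π⁻¹i≡1+a | _ =
      stops-at π⁻¹i≡1+a (gap-bound i+gap≡πa)
        (s2b (m≤i , i+l≡d , in-T (subst (l <_) (sym code≡) (m<n⇒m<1+n (n<1+n l))) , none)
             (in-T (subst (suc l <_) (sym code≡) (n<1+n (suc l)))) (out-T (≤-reflexive code≡)))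
      where
      code≡ : code π i ≡ suc (suc l)
      code≡ = trans (code-next π i π⁻¹i≡1+a (gap-bound i+gap≡πa)) (cong suc rank≡)
    ... | after 1+a<π⁻¹i | zero     = ⊥-elim (after-not-end 1+a<π⁻¹i i+gap≡πa)
    ... | after 1+a<π⁻¹i | suc gap′
      with scan-on gap′ (suc d) (suc i) (suc i) l (trans (sym (+-suc i gap′)) i+gap≡πa) ≤-refl
                   (step-right i≤π[1+a] (>⇒≢ 1+a<π⁻¹i))
                   (trans (sym (rank-suc-row-≥ π i (<⇒≤ (<-trans (n<1+n a) 1+a<π⁻¹i)))) rank≡)
                   (cong suc i+l≡d) (no-cell-in-empty ≤-refl)
    ...   | r , p , outcome =
      r , s2c (m≤i , i+l≡d , in-T (<-≤-trans (m<n⇒m<1+n (n<1+n l)) 2+l≤code) , none)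
              (in-T (<-≤-trans (n<1+n (suc l)) 2+l≤code) ) (in-T 3+l≤code) p , outcome
      where
      3+l≤code : suc (suc (suc l)) ≤ code π i
      3+l≤code = subst (λ k → suc (suc k) ≤ code π i) rank≡
                   (code-after π i 1+a<π⁻¹i (gap-bound i+gap≡πa) i≤π[1+a])
      2+l≤code : suc (suc l) ≤ code π i
      2+l≤code = <⇒≤ 3+l≤code

  slide-outcome : to π 0 ≡ 0 → 1 ≤ a → Σ (Maybe TowerDiagram) λ r → Slide a T r × Outcome r
  slide-outcome π0≡0 (s≤s {n = d} z≤n) with
    scan (pred (to π a)) d 1 1 d (suc-pred (to π a) {{≢-nonZero (to-suc≢0 π π0≡0)}}) ≤-refl
         (n≢0⇒n>0 (to-suc≢0 π π0≡0)) (rank-1 π π0≡0 d) (+-comm d 1) (no-cell-in-empty ≤-refl)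
  ... | r , p , o = r , slide p , o

  outcome : to π 0 ≡ 0 → ∀ {r} → Slide a T r → Outcome r
  outcome π0≡0 (slide p) with slide-outcome π0≡0 (s≤s z≤n)
  ... | _ , slide q , o = subst Outcome (sym (P-deterministic p q)) o

open Sliding using (grows; stops; slide-outcome; outcome)

inversions-run : ∀ {N T π} α → WordBelow N α → PositiveWord α → SupportedBelow N π → T ≐ diagram π →
                 Run T α → inversions N (π ·w α) ≡ inversions N π + length α
inversions-run []      []             []           _    _   done = sym (+-identityʳ _)
inversions-run {N} {π = π} (a ∷ α) (1+a<N ∷ α<N) (1≤a ∷ α>0) supp T≐π (step sl run)
  with outcome π T≐π a (fixes-0 supp) sl
... | grows ascent = begin
  inversions N ((π ·s a) ·w α)
    ≡⟨ inversions-run α α<N α>0 (supported-·s 1≤a 1+a<N supp) (diagram-·s-ascent π a T≐π ascent) run ⟩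
  inversions N (π ·s a) + length α
    ≡⟨ cong (_+ length α) (inversions-·s-ascent π a (to-< supp (<-trans (n<1+n a) 1+a<N)) ascent) ⟩
  suc (inversions N π) + length α
    ≡⟨ +-suc _ _ ⟨
  inversions N π + suc (length α) ∎
  where open ≡-Reasoning

descent-not-reduced : ∀ {N π a} γ α → SupportedBelow N π → suc a < N → to π (suc a) < to π a →
                      (∀ x → to π x ≡ perm γ x) → inversions N π ≡ length γ → PositiveWord α →
                      ¬ Reduced (γ ++ a ∷ α)
descent-not-reduced {N} {π} {a} γ α supp 1+a<N descent π≗γ inv≡ α>0 reduced = <-irrefl refl (begin-strict
  length γ + suc (length α)               ≡⟨ length-++ γ ⟨
  length (γ ++ a ∷ α)                     ≤⟨ reduced (word δ ++ α) (++⁺ (positive δ) α>0) same-perm ⟩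
  length (word δ ++ α)                    ≡⟨ length-++ (word δ) ⟩
  length (word δ) + length α              ≡⟨ cong (_+ length α) (length≡ δ) ⟩
  inversions N (π ·s a) + length α        <⟨ +-monoˡ-< (length α) (n<1+n _) ⟩
  suc (inversions N (π ·s a)) + length α  ≡⟨ cong (_+ length α) one-fewer ⟩
  length γ + length α                     ≤⟨ +-monoʳ-≤ (length γ) (n≤1+n _) ⟩
  length γ + suc (length α)               ∎)
  where
  open ≤-Reasoning
  one-fewer : suc (inversions N (π ·s a)) ≡ length γ
  one-fewer = trans (sym (inversions-·s-descent π a (to-< supp 1+a<N) descent)) inv≡
  δ : Expression N (π ·s a) (inversions N (π ·s a))
  δ = expression _ (supported-·s (descent-positive π (fixes-0 supp) descent) 1+a<N supp) refl
  same-perm : ∀ x → perm (word δ ++ α) x ≡ perm (γ ++ a ∷ α) x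
  same-perm x = begin-equality
    perm (word δ ++ α) x           ≡⟨ perm-++ (word δ) α x ⟩
    perm (word δ) (perm α x)       ≡⟨ represents δ (perm α x) ⟩
    to π (s a (perm α x))          ≡⟨ π≗γ _ ⟩
    perm γ (s a (perm α x))        ≡⟨ perm-++ γ (a ∷ α) x ⟨
    perm (γ ++ a ∷ α) x            ∎

run-of-reduced : ∀ {N T π} γ α → WordBelow N α → PositiveWord α → SupportedBelow N π → T ≐ diagram π →
                 (∀ x → to π x ≡ perm γ x) → inversions N π ≡ length γ → Reduced (γ ++ α) → Run T α
run-of-reduced γ []      []             []           _    _   _   _    _       = done
run-of-reduced {N} {π = π} γ (a ∷ α) (1+a<N ∷ α<N) (1≤a ∷ α>0) supp T≐π π≗γ inv≡ reduced
  with slide-outcome π T≐π a (fixes-0 supp) 1≤a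
... | _ , _  , stops descent = ⊥-elim (descent-not-reduced γ α supp 1+a<N descent π≗γ inv≡ α>0 reduced)
... | _ , sl , grows ascent  =
  step sl (run-of-reduced (γ ++ a ∷ []) α α<N α>0 (supported-·s 1≤a 1+a<N supp) (diagram-·s-ascent π a T≐π ascent)
                          (λ x → trans (π≗γ (s a x)) (sym (perm-++ γ (a ∷ []) x)))
                          (trans (inversions-·s-ascent π a (to-< supp (<-trans (n<1+n a) 1+a<N)) ascent)
                                 (trans (cong suc inv≡) (trans (+-comm 1 _) (sym (length-++ γ)))))
                          (subst Reduced (sym (++-assoc γ (a ∷ []) α)) reduced))

word-below-max : ∀ xs → WordBelow (2 + max 0 xs) xs
word-below-max xs = All.map (λ a≤max → s≤s (s≤s a≤max)) (xs≤max 0 xs)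

reduced-of-run : ∀ α → PositiveWord α → SRDoesNotTerminate α → Reduced α
reduced-of-run α α>0 run β β>0 β≗α = begin
  length α                         ≡⟨ cong (_+ length α) (inversions-id N) ⟨
  inversions N idPerm + length α   ≡⟨ inversions-run α α<N α>0 (supported-id N) diagram-id run ⟨
  inversions N (idPerm ·w α)       ≡⟨ inversions-cong N (idPerm ·w α) (idPerm ·w β) same-perm ⟩
  inversions N (idPerm ·w β)       ≤⟨ inversions-·w-≤ idPerm β β<N β>0 (supported-id N) ⟩
  inversions N idPerm + length β   ≡⟨ cong (_+ length β) (inversions-id N) ⟩
  length β                         ∎
  where
  open ≤-Reasoning
  N : ℕ
  N = 2 + max 0 (α ++ β)
  same-perm : ∀ x → to (idPerm ·w α) x ≡ to (idPerm ·w β) x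
  same-perm x = trans (to-·w idPerm α x) (sym (trans (to-·w idPerm β x) (β≗α x)))
  α<N : WordBelow N α
  α<N = ++⁻ˡ α (word-below-max (α ++ β))
  β<N : WordBelow N β
  β<N = ++⁻ʳ α (word-below-max (α ++ β))

theorem4p3 : (α : List ℕ) → PositiveWord α → (SRDoesNotTerminate α ⇔ Reduced α)
theorem4p3 α α>0 = mk⇔ (reduced-of-run α α>0)
  (run-of-reduced [] α (word-below-max α) α>0 (supported-id N) diagram-id (λ _ → refl) (inversions-id N))
  where
  N : ℕ
  N = 2 + max 0 α
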